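{- For $n\geq1$ let $a_n=n!\sum_{i=1}^{n-1}\frac{1}{i!}$ (so $a_1=0$). For integers $p,q\geq1$ define $a_{p,q}$ by $a_{p,1}=a_p$, $a_{1,q}=a_q$, and, for $p,q\geq2$, $a_{p,q}=\min\big[p(1+a_{p-1,q}),\,q(1+a_{p,q-1})\big]$. Then for all $p\geq2$ and $q\geq2$, $$a_{p,q}=a_{\min(p,q)}+(\min(p,q))!\,a_{\max(p,q)}.$$ -}

module Defs where

open import Data.Nat using (ℕ; zero; suc; _+_; _*_; _/_; _⊓_; _⊔_; _!)
open import Data.Nat.Properties using (_!≢0)

-- Σ_{i=1}^{m} n!/i!   (each term is an exact quotient since i ≤ m < n in use)
sumFrom1 : ℕ → ℕ → ℕ
sumFrom1 n zero    = 0
sumFrom1 n (suc m) = sumFrom1 n m + (n ! / (suc m) !) {{(suc m) !≢0}}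

-- a n = n! * Σ_{i=1}^{n-1} 1/i!  =  Σ_{i=1}^{n-1} n!/i!   (a 1 = 0; a 0 = 0 is junk)
a : ℕ → ℕ
a zero    = 0
a (suc m) = sumFrom1 (suc m) m

-- a₂ p q is a_{p,q} for p, q ≥ 1 (values at p = 0 or q = 0 are junk, set to 0)
a₂ : ℕ → ℕ → ℕ
a₂ zero    _       = 0
a₂ (suc _) zero    = 0
a₂ (suc p) (suc zero) = a (suc p)
a₂ (suc zero) (suc (suc q)) = a (suc (suc q))
a₂ (suc (suc p)) (suc (suc q)) =
  (suc (suc p) * (1 + a₂ (suc p) (suc (suc q))))
    ⊓ (suc (suc q) * (1 + a₂ (suc (suc p)) (suc q)))

-- Unfolding the sum gives a₁ = 0 and aₙ = n (1 + aₙ₋₁), so the closed form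
-- C(p, q) = a_{min} + (min)! a_{max} is checked against the recursion for a_{p,q}.
-- For p ≤ q (the other case is symmetric) the branch p (1 + C(p-1, q)) reproduces C(p, q) exactly, and the other
-- branch is at least as large because a_m + n · m! ≤ n (1 + a_m) whenever m < n;
-- writing n = m + 1 + k, this follows from (m+1)! ≤ m (1 + a_m) + 1 and k · m! ≤ k (1 + a_m).
module Submission where

open import Defs
open import Data.Nat using (ℕ; zero; suc; _+_; _*_; _/_; _≤_; _<_; s≤s; _⊓_; _⊔_; _!)
open import Data.Nat.Properties
open import Data.Nat.DivMod using (*-/-assoc; m*n/n≡m)
open import Data.Nat.Divisibility using (m≤n⇒m!∣n!)
open import Data.Nat.Tactic.RingSolver using (solve-∀)
open import Data.Product using (_,_)
open import Data.Sum using (inj₁; inj₂)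
open import Relation.Binary.PropositionalEquality
  using (_≡_; refl; sym; trans; cong; cong₂; module ≡-Reasoning)

sumFrom1-suc : ∀ {n m} → m ≤ n → sumFrom1 (suc n) m ≡ suc n * sumFrom1 n m
sumFrom1-suc {n} {zero}  _      = sym (*-zeroʳ n)
sumFrom1-suc {n} {suc m} 1+m≤n = begin
  sumFrom1 (suc n) m + (suc n ! / suc m !) {{suc m !≢0}}
    ≡⟨ cong₂ _+_ (sumFrom1-suc (≤-trans (n≤1+n m) 1+m≤n))
                 (*-/-assoc (suc n) {{suc m !≢0}} (m≤n⇒m!∣n! 1+m≤n)) ⟩
  suc n * sumFrom1 n m + suc n * (n ! / suc m !) {{suc m !≢0}}
    ≡⟨ sym (*-distribˡ-+ (suc n) (sumFrom1 n m) _) ⟩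
  suc n * sumFrom1 n (suc m) ∎
  where open ≡-Reasoning

a-rec : ∀ n → a (2 + n) ≡ (2 + n) * (1 + a (1 + n))
a-rec n = begin
  sumFrom1 (2 + n) n + ((2 + n) ! / (1 + n) !) {{(1 + n) !≢0}}
    ≡⟨ cong₂ _+_ (sumFrom1-suc (n≤1+n n)) (m*n/n≡m (2 + n) ((1 + n) !) {{(1 + n) !≢0}}) ⟩
  (2 + n) * a (1 + n) + (2 + n)
    ≡⟨ +-comm _ (2 + n) ⟩
  (2 + n) + (2 + n) * a (1 + n)
    ≡⟨ sym (*-suc (2 + n) (a (1 + n))) ⟩
  (2 + n) * (1 + a (1 + n)) ∎
  where open ≡-Reasoning

n!≤1+a : ∀ n → n ! ≤ 1 + a n
n!≤1+a zero          = ≤-refl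
n!≤1+a (suc zero)    = ≤-refl
n!≤1+a (suc (suc n)) = begin
  (2 + n) * (1 + n) !       ≤⟨ *-monoʳ-≤ (2 + n) (n!≤1+a (suc n)) ⟩
  (2 + n) * (1 + a (1 + n)) ≡⟨ sym (a-rec n) ⟩
  a (2 + n)                 ≤⟨ n≤1+n _ ⟩
  1 + a (2 + n)             ∎
  where open ≤-Reasoning

[1+n]!≤n*[1+a]+1 : ∀ n → (1 + n) ! ≤ n * (1 + a n) + 1
[1+n]!≤n*[1+a]+1 zero          = ≤-refl
[1+n]!≤n*[1+a]+1 (suc zero)    = ≤-refl
[1+n]!≤n*[1+a]+1 (suc (suc n)) = begin
  (3 + n) * (2 + n) !                              ≤⟨ *-monoʳ-≤ (3 + n) ([1+n]!≤n*[1+a]+1 (suc n)) ⟩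
  (3 + n) * ((1 + n) * x + 1)                      ≤⟨ m≤m+n _ x ⟩
  (3 + n) * ((1 + n) * x + 1) + x                  ≡⟨ sym (identity n x) ⟩
  (2 + n) * (1 + (2 + n) * x) + 1                  ≡⟨ cong (λ y → (2 + n) * (1 + y) + 1) (sym (a-rec n)) ⟩
  (2 + n) * (1 + a (2 + n)) + 1                    ∎
  where
    open ≤-Reasoning
    x = 1 + a (1 + n)
    identity : ∀ n x → (2 + n) * (1 + (2 + n) * x) + 1 ≡ (3 + n) * ((1 + n) * x + 1) + x
    identity = solve-∀

a+n*m!≤n*[1+a] : ∀ {m n} → m < n → a m + n * m ! ≤ n * (1 + a m)
a+n*m!≤n*[1+a] {m} m<n with m≤n⇒∃[o]m+o≡n m<n
... | k , refl = begin
  a m + (1 + m + k) * m !                             ≡⟨ cong (a m +_) (*-distribʳ-+ (m !) (1 + m) k) ⟩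
  a m + ((1 + m) ! + k * m !)                         ≤⟨ +-monoʳ-≤ (a m) (+-mono-≤ ([1+n]!≤n*[1+a]+1 m)
                                                                                     (*-monoʳ-≤ k (n!≤1+a m))) ⟩
  a m + (m * (1 + a m) + 1 + k * (1 + a m))           ≡⟨ identity m k (a m) ⟩
  (1 + m + k) * (1 + a m)                             ∎
  where
    open ≤-Reasoning
    identity : ∀ m k x → x + (m * (1 + x) + 1 + k * (1 + x)) ≡ (1 + m + k) * (1 + x)
    identity = solve-∀

closedForm : ℕ → ℕ → ℕ
closedForm p q = a (p ⊓ q) + (p ⊓ q) ! * a (p ⊔ q)

closedForm-comm : ∀ p q → closedForm p q ≡ closedForm q p
closedForm-comm p q rewrite ⊓-comm p q | ⊔-comm p q = refl

closedForm-≤ : ∀ {m n} → m ≤ n → closedForm m n ≡ a m + m ! * a n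
closedForm-≤ m≤n rewrite m≤n⇒m⊓n≡m m≤n | m≤n⇒m⊔n≡n m≤n = refl

closedForm-suc-left : ∀ {m n} → 2 + m ≤ n →
                      (2 + m) * (1 + closedForm (1 + m) n) ≡ closedForm (2 + m) n
closedForm-suc-left {m} {n} 2+m≤n = begin
  (2 + m) * (1 + closedForm (1 + m) n)
    ≡⟨ cong (λ c → (2 + m) * (1 + c)) (closedForm-≤ (≤-trans (n≤1+n (1 + m)) 2+m≤n)) ⟩
  (2 + m) * ((1 + a (1 + m)) + (1 + m) ! * a n)
    ≡⟨ *-distribˡ-+ (2 + m) (1 + a (1 + m)) _ ⟩
  (2 + m) * (1 + a (1 + m)) + (2 + m) * ((1 + m) ! * a n)
    ≡⟨ cong₂ _+_ (sym (a-rec m)) (sym (*-assoc (2 + m) ((1 + m) !) (a n))) ⟩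
  a (2 + m) + (2 + m) ! * a n
    ≡⟨ sym (closedForm-≤ 2+m≤n) ⟩
  closedForm (2 + m) n ∎
  where open ≡-Reasoning

closedForm≤suc-right : ∀ {m n} → m ≤ 1 + n →
                       closedForm m (2 + n) ≤ (2 + n) * (1 + closedForm m (1 + n))
closedForm≤suc-right {m} {n} m≤1+n = begin
  closedForm m (2 + n)
    ≡⟨ closedForm-≤ (m≤n⇒m≤1+n m≤1+n) ⟩
  a m + m ! * a (2 + n)
    ≡⟨ cong (λ y → a m + m ! * y) (a-rec n) ⟩
  a m + m ! * ((2 + n) * (1 + a (1 + n)))
    ≡⟨ identity (a m) (m !) (2 + n) (a (1 + n)) ⟩
  (a m + (2 + n) * m !) + (2 + n) * (m ! * a (1 + n))
    ≤⟨ +-monoˡ-≤ _ (a+n*m!≤n*[1+a] (s≤s m≤1+n)) ⟩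
  (2 + n) * (1 + a m) + (2 + n) * (m ! * a (1 + n))
    ≡⟨ sym (*-distribˡ-+ (2 + n) (1 + a m) _) ⟩
  (2 + n) * (1 + (a m + m ! * a (1 + n)))
    ≡⟨ cong (λ c → (2 + n) * (1 + c)) (sym (closedForm-≤ m≤1+n)) ⟩
  (2 + n) * (1 + closedForm m (1 + n)) ∎
  where
    open ≤-Reasoning
    identity : ∀ x f q y → x + f * (q * (1 + y)) ≡ (x + q * f) + q * (f * y)
    identity = solve-∀

closedForm-rec-≤ : ∀ {p q} → p ≤ q →
  ((2 + p) * (1 + closedForm (1 + p) (2 + q))) ⊓ ((2 + q) * (1 + closedForm (2 + p) (1 + q)))
    ≡ closedForm (2 + p) (2 + q)
closedForm-rec-≤ {p} {q} p≤q =
  trans (m≤n⇒m⊓n≡m {left} {right} (≤-trans (≤-reflexive left≡) closedForm≤right)) left≡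
  where
    left right : ℕ
    left  = (2 + p) * (1 + closedForm (1 + p) (2 + q))
    right = (2 + q) * (1 + closedForm (2 + p) (1 + q))
    left≡ : left ≡ closedForm (2 + p) (2 + q)
    left≡ = closedForm-suc-left (s≤s (s≤s p≤q))
    closedForm≤right : closedForm (2 + p) (2 + q) ≤ right
    closedForm≤right with m≤n⇒m<n∨m≡n p≤q
    ... | inj₁ p<q  = closedForm≤suc-right (s≤s p<q)
    ... | inj₂ refl = ≤-reflexive (trans (sym left≡)
                        (cong (λ c → (2 + p) * (1 + c)) (closedForm-comm (1 + p) (2 + p))))

closedForm-rec : ∀ p q →
  ((2 + p) * (1 + closedForm (1 + p) (2 + q))) ⊓ ((2 + q) * (1 + closedForm (2 + p) (1 + q)))
    ≡ closedForm (2 + p) (2 + q)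
closedForm-rec p q with ≤-total p q
... | inj₁ p≤q = closedForm-rec-≤ p≤q
... | inj₂ q≤p = begin
  ((2 + p) * (1 + closedForm (1 + p) (2 + q))) ⊓ ((2 + q) * (1 + closedForm (2 + p) (1 + q)))
    ≡⟨ ⊓-comm _ _ ⟩
  ((2 + q) * (1 + closedForm (2 + p) (1 + q))) ⊓ ((2 + p) * (1 + closedForm (1 + p) (2 + q)))
    ≡⟨ cong₂ (λ c d → ((2 + q) * (1 + c)) ⊓ ((2 + p) * (1 + d)))
             (closedForm-comm (2 + p) (1 + q)) (closedForm-comm (1 + p) (2 + q)) ⟩
  ((2 + q) * (1 + closedForm (1 + q) (2 + p))) ⊓ ((2 + p) * (1 + closedForm (2 + q) (1 + p)))
    ≡⟨ closedForm-rec-≤ q≤p ⟩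
  closedForm (2 + q) (2 + p)
    ≡⟨ closedForm-comm (2 + q) (2 + p) ⟩
  closedForm (2 + p) (2 + q) ∎
  where open ≡-Reasoning

a₂≡closedForm : ∀ p q → a₂ (1 + p) (1 + q) ≡ closedForm (1 + p) (1 + q)
a₂≡closedForm zero    zero    = refl
a₂≡closedForm (suc p) zero    = sym (+-identityʳ (a (2 + p)))
a₂≡closedForm zero    (suc q) = sym (+-identityʳ (a (2 + q)))
a₂≡closedForm (suc p) (suc q) = trans
  (cong₂ (λ c d → ((2 + p) * (1 + c)) ⊓ ((2 + q) * (1 + d)))
         (a₂≡closedForm p (suc q)) (a₂≡closedForm (suc p) q))
  (closedForm-rec p q)

lemma6 : ∀ (p q : ℕ) → 2 ≤ p → 2 ≤ q →
         a₂ p q ≡ a (p ⊓ q) + (p ⊓ q) ! * a (p ⊔ q)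
lemma6 (suc p) (suc q) _ _ = a₂≡closedForm p q
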